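{- Let $l\leq n$ be positive integers and let $G=K_{l,n}$ with bipartition $\{x_1,\dots,x_l\}$, $\{y_1,\dots,y_n\}$. For any integer $m\geq\chi_\ell(G)$ there exists an $m$-assignment $L$ for $G$ such that $L(y_j)\subseteq\bigcup_{i=1}^l L(x_i)$ for all $j\in[n]$ and $P(G,L)=P_\ell(G,m)$.
   Context: A list assignment $L$ for a graph $G$ assigns to each vertex $v$ a set $L(v)$ of colors; it is an $m$-assignment if $|L(v)|=m$ for all $v$. $P(G,L)$ is the number of proper colorings $f$ of $G$ with $f(v)\in L(v)$ for all $v$. $\chi_\ell(G)$ is the list chromatic number: the least $k$ such that $G$ has a proper $L$-coloring for every $k$-assignment $L$. $P_\ell(G,m)$ is the minimum of $P(G,L)$ over all $m$-assignments $L$ for $G$. $[n]=\{1,\dots,n\}$. -}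

module Defs where

open import Data.Nat using (ℕ; zero; suc; _+_; _≤_; _≟_)
open import Data.Bool using (Bool; true; false; _xor_)
open import Data.Fin using (Fin; zero; suc; _↑ˡ_; _↑ʳ_)
open import Data.Fin.Properties using (all?)
open import Data.Sum using (_⊎_; inj₁; inj₂)
open import Data.Fin using (splitAt)
open import Data.List using (List; []; _∷_; length; concatMap; map; filter)
open import Data.List.Relation.Unary.Unique.Propositional using (Unique)
open import Data.List.Membership.Propositional using (_∈_)
open import Data.Vec using (Vec; []; _∷_; lookup)
open import Data.Product using (Σ; _×_; ∃-syntax)
open import Relation.Nullary using (¬_; Dec)
open import Relation.Nullary.Decidable using (_→-dec_; ¬?)
open import Relation.Binary.PropositionalEquality using (_≡_; _≢_)
import Data.Bool.Properties as BoolP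

record Graph : Set where
  field
    N   : ℕ
    Adj : Fin N → Fin N → Bool
open Graph public

-- Complete bipartite graph K_{l,n}: vertices Fin (l + n);
-- x_i = i ↑ˡ n  (i : Fin l),  y_j = l ↑ʳ j  (j : Fin n).
side : (l n : ℕ) → Fin (l + n) → Bool
side l n v with splitAt l v
... | inj₁ _ = true
... | inj₂ _ = false

K : ℕ → ℕ → Graph
K l n = record { N = l + n ; Adj = λ u v → side l n u xor side l n v }

xv : (l n : ℕ) → Fin l → Fin (l + n)
xv l n i = i ↑ˡ n

yv : (l n : ℕ) → Fin n → Fin (l + n)
yv l n j = l ↑ʳ j

-- List assignments: colors are natural numbers; each vertex gets a finite set
-- (a duplicate-free list) of colors.
ListAssignment : Graph → Set
ListAssignment G = Fin (N G) → List ℕ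

IsAssignment : (G : Graph) → ℕ → ListAssignment G → Set
IsAssignment G m L = ∀ v → Unique (L v) × length (L v) ≡ m

Proper : (G : Graph) → Vec ℕ (N G) → Set
Proper G c = ∀ u v → Adj G u v ≡ true → lookup c u ≢ lookup c v

proper? : (G : Graph) → (c : Vec ℕ (N G)) → Dec (Proper G c)
proper? G c = all? λ u → all? λ v → (Adj G u v BoolP.≟ true) →-dec ¬? (lookup c u ≟ lookup c v)

ProperLColoring : (G : Graph) → ListAssignment G → Vec ℕ (N G) → Set
ProperLColoring G L c = (∀ v → lookup c v ∈ L v) × Proper G c

choices : (k : ℕ) → (Fin k → List ℕ) → List (Vec ℕ k)
choices zero    L = [] ∷ []
choices (suc k) L = concatMap (λ a → map (a ∷_) (choices k (λ v → L (suc v)))) (L zero)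

P : (G : Graph) → ListAssignment G → ℕ
P G L = length (filter (proper? G) (choices (N G) L))

Choosable : Graph → ℕ → Set
Choosable G k = ∀ L → IsAssignment G k L → ∃[ c ] ProperLColoring G L c

IsListChromaticNumber : Graph → ℕ → Set
IsListChromaticNumber G k = Choosable G k × (∀ k′ → Choosable G k′ → k ≤ k′)

-- P(G, L) = P_ℓ(G, m) for an m-assignment L: P(G,L) is the minimum over all m-assignments.
AttainsPℓ : (G : Graph) → ℕ → ListAssignment G → Set
AttainsPℓ G m L = ∀ L′ → IsAssignment G m L′ → P G L ≤ P G L′

{-# OPTIONS --safe #-}
-- Renaming the colors of an m-assignment injectively to positions in the list of all its colors
-- does not increase P and bounds every color by (l + n) m. Next, while some y_j has a color c lying
-- in no list of an x-vertex, replace c in L(y_j) by some d ∈ L(x₁) ∖ L(y_j), which exists because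
-- c ∉ L(x₁) and |L(x₁)| = |L(y_j)|. Sending d back to c at y_j maps proper colorings injectively
-- to proper colorings, since c clashes with no color of an x-vertex; so P does not increase.
-- Hence every m-assignment is dominated by a covered one with colors below (l + n) m, and among
-- these finitely many assignments one minimising P attains P_ℓ(K_{l,n}, m).
module Submission where

open import Defs
open import Data.Nat using (ℕ; zero; suc; _+_; _*_; _≤_; _<_; z≤n; s≤s; _≟_)
open import Data.Nat.Properties using (≤-reflexive; ≤-trans; +-suc; m≤n⇒m≤1+n; n≮n; module ≤-Reasoning)
open import Data.Nat.Induction using (<-wellFounded)
open import Induction.WellFounded using (Acc; acc)
open import Data.Bool using (true; false)
open import Data.Fin using (Fin; zero; suc; splitAt)
open import Data.Fin.Properties using (splitAt-↑ˡ; splitAt-↑ʳ; splitAt⁻¹-↑ˡ; splitAt⁻¹-↑ʳ)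
import Data.Fin.Properties as Fin
open import Data.Vec using (Vec; []; _∷_; lookup; tabulate)
open import Data.Vec.Properties using (∷-injective; lookup∘tabulate; tabulate∘lookup; tabulate-cong)
open import Data.List using (List; []; _∷_; [_]; length; map; filter; concatMap; _++_; cartesianProductWith; upTo)
open import Data.List.Properties using (length-++; length-map; length-upTo)
open import Data.List.Relation.Unary.All as All using (All; []; _∷_)
open import Data.List.Relation.Unary.All.Properties using (¬All⇒Any¬) renaming (map⁺ to All-map⁺)
open import Data.List.Relation.Unary.Any as Any using (here; there)
open import Data.List.Relation.Unary.Unique.Propositional using (Unique; []; _∷_)
import Data.List.Relation.Unary.Unique.Propositional.Properties as Unique
open import Data.List.Relation.Unary.Unique.DecPropositional _≟_ using (unique?)
open import Data.List.Relation.Binary.Subset.Propositional using (_⊆_)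
open import Data.List.Membership.Propositional using (_∈_; _∉_; find; lose)
open import Data.List.Membership.Propositional.Properties
  using (∈-∃++; ∈-++⁻; ∈-++⁺ˡ; ∈-++⁺ʳ; ∈-map⁻; ∈-filter⁺; ∈-filter⁻; ∈-upTo⁺;
         ∈-cartesianProductWith⁺; ∈-cartesianProductWith⁻)
open import Data.List.Membership.DecPropositional _≟_ using (_∈?_)
open import Data.List.Extrema.Nat using (argmin; argmin-sel; f[argmin]≤f[⊤]; f[argmin]≤f[xs])
open import Data.Product using (_×_; _,_; ∃-syntax; proj₁; proj₂)
open import Data.Sum using (inj₁; inj₂; [_,_]′)
open import Data.Empty using (⊥-elim)
open import Function using (_∘_; id)
open import Relation.Nullary using (¬_; yes; no)
open import Relation.Nullary.Decidable using (_×-dec_; ¬?; map′; decidable-stable)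
open import Relation.Unary using (Decidable)
open import Relation.Binary.PropositionalEquality
  using (_≡_; _≢_; refl; sym; trans; cong; cong₂; subst; module ≡-Reasoning)

module _ {A : Set} where

  Unique⇒length≤ : ∀ {xs ys : List A} → Unique xs → xs ⊆ ys → length xs ≤ length ys
  Unique⇒length≤ {[]}     _             _     = z≤n
  Unique⇒length≤ {x ∷ xs} (x∉xs ∷ uxs) xs⊆ys with ∈-∃++ (xs⊆ys (here refl))
  ... | ys₁ , ys₂ , refl = ≤-trans (s≤s (Unique⇒length≤ uxs xs⊆ys₁++ys₂)) (≤-reflexive length-removed)
    where
    open ≡-Reasoning
    xs⊆ys₁++ys₂ : xs ⊆ ys₁ ++ ys₂
    xs⊆ys₁++ys₂ {y} y∈xs with ∈-++⁻ ys₁ (xs⊆ys (there y∈xs))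
    ... | inj₁ y∈ys₁        = ∈-++⁺ˡ y∈ys₁
    ... | inj₂ (here y≡x)   = ⊥-elim (All.lookup x∉xs y∈xs (sym y≡x))
    ... | inj₂ (there y∈ys₂) = ∈-++⁺ʳ ys₁ y∈ys₂
    length-removed : suc (length (ys₁ ++ ys₂)) ≡ length (ys₁ ++ x ∷ ys₂)
    length-removed = begin
      suc (length (ys₁ ++ ys₂))        ≡⟨ cong suc (length-++ ys₁) ⟩
      suc (length ys₁ + length ys₂)    ≡⟨ sym (+-suc (length ys₁) (length ys₂)) ⟩
      length ys₁ + length (x ∷ ys₂)    ≡⟨ sym (length-++ ys₁) ⟩
      length (ys₁ ++ x ∷ ys₂)          ∎

module _ {A B : Set} (f : A → B) where

  map⁺-injectiveOn : ∀ {xs} → (∀ {x y} → x ∈ xs → y ∈ xs → f x ≡ f y → x ≡ y)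
                   → Unique xs → Unique (map f xs)
  map⁺-injectiveOn {[]}     _   []           = []
  map⁺-injectiveOn {x ∷ xs} inj (x∉xs ∷ uxs) =
    All-map⁺ (All.tabulate λ y∈xs fx≡fy → All.lookup x∉xs y∈xs (inj (here refl) (there y∈xs) fx≡fy))
    ∷ map⁺-injectiveOn (λ x∈ y∈ → inj (there x∈) (there y∈)) uxs

  map⁺-leftInverseOn : ∀ {g : B → A} {xs} → (∀ {x} → x ∈ xs → g (f x) ≡ x)
                     → Unique xs → Unique (map f xs)
  map⁺-leftInverseOn {g} gf≡id =
    map⁺-injectiveOn λ x∈ y∈ fx≡fy → trans (sym (gf≡id x∈)) (trans (cong g fx≡fy) (gf≡id y∈))

missing-element : ∀ {xs ys : List ℕ} {c} → Unique xs → c ∉ xs → c ∈ ys → length ys ≤ length xs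
                → ∃[ d ] (d ∈ xs × d ∉ ys)
missing-element {xs} {ys} {c} uxs c∉xs c∈ys ys≤xs with Any.any? (λ d → ¬? (d ∈? ys)) xs
... | yes some-missing = find some-missing
... | no none-missing  = ⊥-elim (n≮n (length xs) (≤-trans (Unique⇒length≤ uc∷xs c∷xs⊆ys) ys≤xs))
  where
  uc∷xs : Unique (c ∷ xs)
  uc∷xs = All.tabulate (λ d∈xs c≡d → c∉xs (subst (_∈ xs) (sym c≡d) d∈xs)) ∷ uxs
  c∷xs⊆ys : c ∷ xs ⊆ ys
  c∷xs⊆ys (here refl)  = c∈ys
  c∷xs⊆ys (there d∈xs) = decidable-stable (_ ∈? ys) (none-missing ∘ lose d∈xs)

colors : (k : ℕ) → (Fin k → List ℕ) → List ℕ
colors zero    L = []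
colors (suc k) L = L zero ++ colors k (L ∘ suc)

∈-colors⁺ : ∀ k (L : Fin k → List ℕ) v {c} → c ∈ L v → c ∈ colors k L
∈-colors⁺ (suc k) L zero    c∈ = ∈-++⁺ˡ c∈
∈-colors⁺ (suc k) L (suc v) c∈ = ∈-++⁺ʳ (L zero) (∈-colors⁺ k (L ∘ suc) v c∈)

length-colors : ∀ k (L : Fin k → List ℕ) {m} → (∀ v → length (L v) ≡ m) → length (colors k L) ≡ k * m
length-colors zero    L _   = refl
length-colors (suc k) L len =
  trans (length-++ (L zero)) (cong₂ _+_ (len zero) (length-colors k (L ∘ suc) (len ∘ suc)))

position : ℕ → List ℕ → ℕ
position c []       = 0
position c (x ∷ xs) with c ≟ x
... | yes _ = 0
... | no  _ = suc (position c xs)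

-- 0 is a junk value: only positions below the length of the list are ever used.
nth : List ℕ → ℕ → ℕ
nth []       _       = 0
nth (x ∷ xs) zero    = x
nth (x ∷ xs) (suc i) = nth xs i

nth-position : ∀ {c} xs → c ∈ xs → nth xs (position c xs) ≡ c
nth-position {c} (x ∷ xs) c∈ with c ≟ x | c∈
... | yes c≡x | _          = sym c≡x
... | no  c≢x | here c≡x   = ⊥-elim (c≢x c≡x)
... | no  _   | there c∈xs = nth-position xs c∈xs

position-< : ∀ {c} xs → c ∈ xs → position c xs < length xs
position-< {c} (x ∷ xs) c∈ with c ≟ x | c∈
... | yes _   | _          = s≤s z≤n
... | no  c≢x | here c≡x   = ⊥-elim (c≢x c≡x)
... | no  _   | there c∈xs = s≤s (position-< xs c∈xs)

concatMap-map≡cartesianProductWith : ∀ {A B C : Set} (f : A → B → C) as bs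
  → concatMap (λ a → map (f a) bs) as ≡ cartesianProductWith f as bs
concatMap-map≡cartesianProductWith f []       bs = refl
concatMap-map≡cartesianProductWith f (a ∷ as) bs =
  cong (map (f a) bs ++_) (concatMap-map≡cartesianProductWith f as bs)

choices-suc : ∀ k (L : Fin (suc k) → List ℕ)
  → choices (suc k) L ≡ cartesianProductWith _∷_ (L zero) (choices k (L ∘ suc))
choices-suc k L = concatMap-map≡cartesianProductWith _∷_ (L zero) (choices k (L ∘ suc))

∈-choices⁺ : ∀ k (L : Fin k → List ℕ) {c : Vec ℕ k} → (∀ v → lookup c v ∈ L v) → c ∈ choices k L
∈-choices⁺ zero    L {[]}    _   = here refl
∈-choices⁺ (suc k) L {a ∷ c} c∈L = subst (a ∷ c ∈_) (sym (choices-suc k L))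
  (∈-cartesianProductWith⁺ _∷_ (c∈L zero) (∈-choices⁺ k (L ∘ suc) (c∈L ∘ suc)))

∈-choices⁻ : ∀ k (L : Fin k → List ℕ) {c : Vec ℕ k} → c ∈ choices k L → ∀ v → lookup c v ∈ L v
∈-choices⁻ (suc k) L {a ∷ c} c∈
  with ∈-cartesianProductWith⁻ _∷_ (L zero) _ (subst (a ∷ c ∈_) (choices-suc k L) c∈)
... | _ , _ , a∈ , c∈′ , refl = λ { zero → a∈ ; (suc v) → ∈-choices⁻ k (L ∘ suc) c∈′ v }

choices⁺ : ∀ k (L : Fin k → List ℕ) → (∀ v → Unique (L v)) → Unique (choices k L)
choices⁺ zero    L _  = [] ∷ []
choices⁺ (suc k) L uL = subst Unique (sym (choices-suc k L))
  (Unique.cartesianProductWith⁺ _∷_ ∷-injective (uL zero) (choices⁺ k (L ∘ suc) (uL ∘ suc)))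

listsOver : ∀ {A : Set} → ℕ → List A → List (List A)
listsOver zero    as = [ [] ]
listsOver (suc m) as = cartesianProductWith _∷_ as (listsOver m as)

∈-listsOver⁺ : ∀ {A : Set} {as : List A} xs → All (_∈ as) xs → xs ∈ listsOver (length xs) as
∈-listsOver⁺ []       []           = here refl
∈-listsOver⁺ (x ∷ xs) (x∈ ∷ xs∈) = ∈-cartesianProductWith⁺ _∷_ x∈ (∈-listsOver⁺ xs xs∈)

vectorsOver : ∀ {A : Set} k → List A → List (Vec A k)
vectorsOver zero    as = [ [] ]
vectorsOver (suc k) as = cartesianProductWith _∷_ as (vectorsOver k as)

∈-vectorsOver⁺ : ∀ {A : Set} {as : List A} {k} (u : Vec A k) → (∀ v → lookup u v ∈ as) → u ∈ vectorsOver k as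
∈-vectorsOver⁺ []      _    = here refl
∈-vectorsOver⁺ (x ∷ u) u∈as = ∈-cartesianProductWith⁺ _∷_ (u∈as zero) (∈-vectorsOver⁺ u (u∈as ∘ suc))

∃-minimal : ∀ {A : Set} (key : A → ℕ) {a : A} {xs} → a ∈ xs
  → ∃[ b ] (b ∈ xs × All (λ x → key b ≤ key x) xs)
∃-minimal key {xs = x ∷ xs} _ =
  argmin key x xs
  , [ here , there ]′ (argmin-sel key x xs)
  , f[argmin]≤f[⊤] {f = key} x xs ∷ f[argmin]≤f[xs] {f = key} x xs

properColorings : (G : Graph) → ListAssignment G → List (Vec ℕ (N G))
properColorings G L = filter (proper? G) (choices (N G) L)

∈-properColorings⁺ : ∀ G L {c} → ProperLColoring G L c → c ∈ properColorings G L
∈-properColorings⁺ G L (c∈L , proper) = ∈-filter⁺ (proper? G) (∈-choices⁺ (N G) L c∈L) proper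

∈-properColorings⁻ : ∀ G L {c} → c ∈ properColorings G L → ProperLColoring G L c
∈-properColorings⁻ G L c∈ with ∈-filter⁻ (proper? G) c∈
... | c∈choices , proper = ∈-choices⁻ (N G) L c∈choices , proper

record Recoloring (G : Graph) (L L′ : ListAssignment G) : Set where
  field
    recolor           : Fin (N G) → ℕ → ℕ
    recolor-∈         : ∀ v {a} → a ∈ L v → recolor v a ∈ L′ v
    recolor-injective : ∀ v {a b} → a ∈ L v → b ∈ L v → recolor v a ≡ recolor v b → a ≡ b
    recolor-adjacent  : ∀ u v {a b} → Adj G u v ≡ true → a ∈ L u → b ∈ L v
                      → recolor u a ≡ recolor v b → a ≡ b

module _ {G : Graph} {L L′ : ListAssignment G} (ρ : Recoloring G L L′) where

  open Recoloring ρ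

  recolorColoring : Vec ℕ (N G) → Vec ℕ (N G)
  recolorColoring c = tabulate λ v → recolor v (lookup c v)

  lookup-recolorColoring : ∀ c v → lookup (recolorColoring c) v ≡ recolor v (lookup c v)
  lookup-recolorColoring c = lookup∘tabulate (λ v → recolor v (lookup c v))

  recolorColoring-proper : ∀ {c} → ProperLColoring G L c → ProperLColoring G L′ (recolorColoring c)
  recolorColoring-proper {c} (c∈L , proper) = c′∈L′ , proper′
    where
    c′∈L′ : ∀ v → lookup (recolorColoring c) v ∈ L′ v
    c′∈L′ v = subst (_∈ L′ v) (sym (lookup-recolorColoring c v)) (recolor-∈ v (c∈L v))
    proper′ : Proper G (recolorColoring c)
    proper′ u v uv c′u≡c′v = proper u v uv (recolor-adjacent u v uv (c∈L u) (c∈L v)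
      (trans (sym (lookup-recolorColoring c u)) (trans c′u≡c′v (lookup-recolorColoring c v))))

  recolorColoring-injective : ∀ {c d} → ProperLColoring G L c → ProperLColoring G L d
    → recolorColoring c ≡ recolorColoring d → c ≡ d
  recolorColoring-injective {c} {d} (c∈L , _) (d∈L , _) c′≡d′ =
    trans (sym (tabulate∘lookup c)) (trans (tabulate-cong pointwise) (tabulate∘lookup d))
    where
    pointwise : ∀ v → lookup c v ≡ lookup d v
    pointwise v = recolor-injective v (c∈L v) (d∈L v)
      (trans (sym (lookup-recolorColoring c v)) (trans (cong (λ e → lookup e v) c′≡d′) (lookup-recolorColoring d v)))

  P-mono : (∀ v → Unique (L v)) → P G L ≤ P G L′
  P-mono uL = begin
    length (properColorings G L)                        ≡⟨ sym (length-map recolorColoring (properColorings G L)) ⟩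
    length (map recolorColoring (properColorings G L))  ≤⟨ Unique⇒length≤ unique image⊆ ⟩
    length (properColorings G L′)                       ∎
    where
    open ≤-Reasoning
    unique : Unique (map recolorColoring (properColorings G L))
    unique = map⁺-injectiveOn recolorColoring
      (λ c∈ d∈ → recolorColoring-injective (∈-properColorings⁻ G L c∈) (∈-properColorings⁻ G L d∈))
      (Unique.filter⁺ (proper? G) (choices⁺ (N G) L uL))
    image⊆ : map recolorColoring (properColorings G L) ⊆ properColorings G L′
    image⊆ c′∈ with ∈-map⁻ recolorColoring c′∈
    ... | c , c∈ , refl = ∈-properColorings⁺ G L′ (recolorColoring-proper {c} (∈-properColorings⁻ G L c∈))

pointwise-recoloring : ∀ {G} {L L′ : ListAssignment G} → (∀ v → L v ≡ L′ v) → Recoloring G L L′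
pointwise-recoloring L≗L′ = record
  { recolor           = λ _ a → a
  ; recolor-∈         = λ v → subst (_ ∈_) (L≗L′ v)
  ; recolor-injective = λ _ _ _ a≡b → a≡b
  ; recolor-adjacent  = λ _ _ _ _ _ a≡b → a≡b
  }

module _ {G : Graph} (L : ListAssignment G) (σ τ : ℕ → ℕ) (τσ≡id : ∀ v {c} → c ∈ L v → τ (σ c) ≡ c) where

  renamed : ListAssignment G
  renamed v = map σ (L v)

  private
    renamed⁻ : ∀ v {a} → a ∈ renamed v → ∃[ c ] (c ∈ L v × a ≡ σ c)
    renamed⁻ v = ∈-map⁻ σ

    τ-reflects-≡ : ∀ u v {a b} → a ∈ renamed u → b ∈ renamed v → τ a ≡ τ b → a ≡ b
    τ-reflects-≡ u v a∈ b∈ τa≡τb with renamed⁻ u a∈ | renamed⁻ v b∈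
    ... | c , c∈ , refl | d , d∈ , refl =
      cong σ (trans (sym (τσ≡id u c∈)) (trans τa≡τb (τσ≡id v d∈)))

  renaming-recoloring : Recoloring G renamed L
  renaming-recoloring = record
    { recolor           = λ _ → τ
    ; recolor-∈         = recolor-∈
    ; recolor-injective = λ v → τ-reflects-≡ v v
    ; recolor-adjacent  = λ u v _ → τ-reflects-≡ u v
    }
    where
    recolor-∈ : ∀ v {a} → a ∈ renamed v → τ a ∈ L v
    recolor-∈ v a∈ with renamed⁻ v a∈
    ... | c , c∈ , refl = subst (_∈ L v) (sym (τσ≡id v c∈)) c∈

  renamed⁺ : ∀ v → Unique (L v) → Unique (renamed v)
  renamed⁺ v = map⁺-leftInverseOn σ {g = τ} (τσ≡id v)

record InjectionFixing (X : ℕ → Set) (zs ys : List ℕ) : Set where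
  field
    ρ           : ℕ → ℕ
    ρ-∈         : ∀ {a} → a ∈ zs → ρ a ∈ ys
    ρ-injective : ∀ {a b} → a ∈ zs → b ∈ zs → ρ a ≡ ρ b → a ≡ b
    ρ-fixes     : ∀ {a} → a ∈ zs → X (ρ a) → ρ a ≡ a

module _ {X : ℕ → Set} where

  InjectionFixing-refl : ∀ {ys} → InjectionFixing X ys ys
  InjectionFixing-refl = record
    { ρ = id ; ρ-∈ = id ; ρ-injective = λ _ _ a≡b → a≡b ; ρ-fixes = λ _ _ → refl }

  InjectionFixing-trans : ∀ {zs ys ws} → InjectionFixing X zs ys → InjectionFixing X ys ws
                        → InjectionFixing X zs ws
  InjectionFixing-trans ι κ = record
    { ρ           = K.ρ ∘ I.ρ
    ; ρ-∈         = K.ρ-∈ ∘ I.ρ-∈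
    ; ρ-injective = λ a∈ b∈ → I.ρ-injective a∈ b∈ ∘ K.ρ-injective (I.ρ-∈ a∈) (I.ρ-∈ b∈)
    ; ρ-fixes     = fixes
    }
    where
    module I = InjectionFixing ι
    module K = InjectionFixing κ
    fixes : ∀ {a} → a ∈ _ → X (K.ρ (I.ρ a)) → K.ρ (I.ρ a) ≡ a
    fixes a∈ X-κιa with K.ρ-fixes (I.ρ-∈ a∈) X-κιa
    ... | κιa≡ιa = trans κιa≡ιa (I.ρ-fixes a∈ (subst X κιa≡ιa X-κιa))

replace : ℕ → ℕ → ℕ → ℕ
replace c d e with e ≟ c
... | yes _ = d
... | no  _ = e

replace-cancel : ∀ c d {e} → e ≢ d → replace d c (replace c d e) ≡ e
replace-cancel c d {e} e≢d with e ≟ c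
... | yes e≡c rewrite e≡c with d ≟ d
...   | yes _   = refl
...   | no  d≢d = ⊥-elim (d≢d refl)
replace-cancel c d {e} e≢d | no _ with e ≟ d
...   | yes e≡d = ⊥-elim (e≢d e≡d)
...   | no  _   = refl

replace-cancelOn : ∀ c d {ys} → d ∉ ys → ∀ {e} → e ∈ ys → replace d c (replace c d e) ≡ e
replace-cancelOn c d d∉ys e∈ys = replace-cancel c d λ { refl → d∉ys e∈ys }

replace-self : ∀ c d → replace c d c ≡ d
replace-self c d with c ≟ c
... | yes _   = refl
... | no  c≢c = ⊥-elim (c≢c refl)

replace-preserves : ∀ (P : ℕ → Set) c d {e} → P d → P e → P (replace c d e)
replace-preserves P c d {e} Pd Pe with e ≟ c
... | yes _ = Pd
... | no  _ = Pe

module _ {X : ℕ → Set} where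

  replace-injection : ∀ {ys c d} → ¬ X c → d ∉ ys → InjectionFixing X (map (replace c d) ys) ys
  replace-injection {ys} {c} {d} ¬Xc d∉ys = record
    { ρ           = replace d c
    ; ρ-∈         = ρ-∈
    ; ρ-injective = ρ-injective
    ; ρ-fixes     = ρ-fixes
    }
    where
    cancel : ∀ {e} → e ∈ ys → replace d c (replace c d e) ≡ e
    cancel = replace-cancelOn c d d∉ys
    ρ-∈ : ∀ {a} → a ∈ map (replace c d) ys → replace d c a ∈ ys
    ρ-∈ a∈ with ∈-map⁻ (replace c d) a∈
    ... | e , e∈ys , refl = subst (_∈ ys) (sym (cancel e∈ys)) e∈ys
    ρ-injective : ∀ {a b} → a ∈ map (replace c d) ys → b ∈ map (replace c d) ys
                → replace d c a ≡ replace d c b → a ≡ b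
    ρ-injective a∈ b∈ ρa≡ρb with ∈-map⁻ (replace c d) a∈ | ∈-map⁻ (replace c d) b∈
    ... | e , e∈ys , refl | f , f∈ys , refl =
      cong (replace c d) (trans (sym (cancel e∈ys)) (trans ρa≡ρb (cancel f∈ys)))
    ρ-fixes : ∀ {a} → a ∈ map (replace c d) ys → X (replace d c a) → replace d c a ≡ a
    ρ-fixes {a} _ Xρa with a ≟ d
    ... | yes _ = ⊥-elim (¬Xc Xρa)
    ... | no  _ = refl

record Repaired (X : ℕ → Set) (ys : List ℕ) : Set where
  constructor repaired
  field
    zs        : List ℕ
    zs⊆X      : All X zs
    zs-unique : Unique zs
    zs-length : length zs ≡ length ys
    zs↪ys     : InjectionFixing X zs ys

Repaired-replace : ∀ {X ys c d} → ¬ X c → d ∉ ys → Repaired X (map (replace c d) ys) → Repaired X ys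
Repaired-replace {ys = ys} {c} {d} ¬Xc d∉ys (repaired zs zs⊆X uzs zs≡ys′ ι) =
  repaired zs zs⊆X uzs (trans zs≡ys′ (length-map (replace c d) ys))
    (InjectionFixing-trans ι (replace-injection ¬Xc d∉ys))

module _ {X : ℕ → Set} (X? : Decidable X) where

  outside : List ℕ → ℕ
  outside []       = 0
  outside (e ∷ es) with X? e
  ... | yes _ = outside es
  ... | no  _ = suc (outside es)

  outside-map-≤ : ∀ {f} → (∀ {e} → X e → X (f e)) → ∀ es → outside (map f es) ≤ outside es
  outside-map-≤     f-pres []       = z≤n
  outside-map-≤ {f} f-pres (e ∷ es) with X? (f e) | X? e
  ... | yes _   | yes _  = outside-map-≤ f-pres es
  ... | yes _   | no  _  = m≤n⇒m≤1+n (outside-map-≤ f-pres es)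
  ... | no ¬Xfe | yes Xe = ⊥-elim (¬Xfe (f-pres Xe))
  ... | no _    | no  _  = s≤s (outside-map-≤ f-pres es)

  outside-map-< : ∀ {f c} → (∀ {e} → X e → X (f e)) → ¬ X c → X (f c)
                → ∀ {es} → c ∈ es → outside (map f es) < outside es
  outside-map-< {f} f-pres ¬Xc Xfc {e ∷ es} c∈ with X? (f e) | X? e | c∈
  ... | _       | yes Xe | here refl  = ⊥-elim (¬Xc Xe)
  ... | no ¬Xfe | _      | here refl  = ⊥-elim (¬Xfe Xfc)
  ... | yes _   | no _   | here refl  = s≤s (outside-map-≤ f-pres es)
  ... | yes _   | yes _  | there c∈es = outside-map-< f-pres ¬Xc Xfc c∈es
  ... | yes _   | no _   | there c∈es = m≤n⇒m≤1+n (outside-map-< f-pres ¬Xc Xfc c∈es)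
  ... | no ¬Xfe | yes Xe | there _    = ⊥-elim (¬Xfe (f-pres Xe))
  ... | no _    | no _   | there c∈es = s≤s (outside-map-< f-pres ¬Xc Xfc c∈es)

  outside-replace-< : ∀ {c d es} → c ∈ es → ¬ X c → X d → outside (map (replace c d) es) < outside es
  outside-replace-< {c} {d} c∈es ¬Xc Xd =
    outside-map-< (replace-preserves X c d Xd) ¬Xc (subst X (sym (replace-self c d)) Xd) c∈es

  -- Each color c of ys outside X is exchanged for a color d of A missing from ys; there
  -- is one since A ⊆ X avoids c and is as long as ys.
  repair : ∀ {A} → All X A → Unique A → ∀ ys → Unique ys → length ys ≡ length A → Repaired X ys
  repair {A} A⊆X uA ys = go ys (<-wellFounded (outside ys))
    where
    go : ∀ ys → Acc _<_ (outside ys) → Unique ys → length ys ≡ length A → Repaired X ys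
    go ys (acc rec) uys ys≡A with All.all? X? ys
    ... | yes ys⊆X = repaired ys ys⊆X uys refl InjectionFixing-refl
    ... | no ys⊈X with find (¬All⇒Any¬ X? ys ys⊈X)
    ... | c , c∈ys , ¬Xc with missing-element uA (λ c∈A → ¬Xc (All.lookup A⊆X c∈A)) c∈ys (≤-reflexive ys≡A)
    ... | d , d∈A , d∉ys = Repaired-replace ¬Xc d∉ys
      (go (map (replace c d) ys) (rec (outside-replace-< c∈ys ¬Xc (All.lookup A⊆X d∈A)))
          (map⁺-leftInverseOn (replace c d) {g = replace d c} (replace-cancelOn c d d∉ys) uys)
          (trans (length-map (replace c d) ys) ys≡A))

module _ (l n : ℕ) where

  data Side : Fin (l + n) → Set where
    left  : (i : Fin l) → Side (xv l n i)
    right : (j : Fin n) → Side (yv l n j)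

  side-view : ∀ v → Side v
  side-view v with splitAt l v in eq
  ... | inj₁ i = subst Side (splitAt⁻¹-↑ˡ eq) (left i)
  ... | inj₂ j = subst Side (splitAt⁻¹-↑ʳ eq) (right j)

  side-xv : ∀ i → side l n (xv l n i) ≡ true
  side-xv i rewrite splitAt-↑ˡ l i n = refl

  side-yv : ∀ j → side l n (yv l n j) ≡ false
  side-yv j rewrite splitAt-↑ʳ l n j = refl

  xv-xv-nonadjacent : ∀ i i′ → Adj (K l n) (xv l n i) (xv l n i′) ≢ true
  xv-xv-nonadjacent i i′ rewrite side-xv i | side-xv i′ = λ ()

  yv-yv-nonadjacent : ∀ j j′ → Adj (K l n) (yv l n j) (yv l n j′) ≢ true
  yv-yv-nonadjacent j j′ rewrite side-yv j | side-yv j′ = λ ()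

  bySide : ∀ {A : Set} → (Fin l → A) → (Fin n → A) → Fin (l + n) → A
  bySide f g v = [ f , g ]′ (splitAt l v)

  bySide-xv : ∀ {A : Set} (f : Fin l → A) g i → bySide f g (xv l n i) ≡ f i
  bySide-xv f g i = cong [ f , g ]′ (splitAt-↑ˡ l i n)

  bySide-yv : ∀ {A : Set} (f : Fin l → A) g j → bySide f g (yv l n j) ≡ g j
  bySide-yv f g j = cong [ f , g ]′ (splitAt-↑ʳ l n j)

  Covered : ListAssignment (K l n) → Set
  Covered L = ∀ (j : Fin n) (c : ℕ) → c ∈ L (yv l n j) → ∃[ i ] c ∈ L (xv l n i)

module _ (l n : ℕ) {m : ℕ} (x₀ : Fin l) (L : ListAssignment (K l n)) (isA : IsAssignment (K l n) m L) where

  private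
    InX : ℕ → Set
    InX c = ∃[ i ] c ∈ L (xv l n i)

    InX? : Decidable InX
    InX? c = Fin.any? λ i → c ∈? L (xv l n i)

    repairs : (j : Fin n) → Repaired InX (L (yv l n j))
    repairs j = repair InX? (All.tabulate (x₀ ,_)) (proj₁ (isA (xv l n x₀)))
      (L (yv l n j)) (proj₁ (isA (yv l n j)))
      (trans (proj₂ (isA (yv l n j))) (sym (proj₂ (isA (xv l n x₀)))))

    module R (j : Fin n) = Repaired (repairs j)
    module ρ (j : Fin n) = InjectionFixing (R.zs↪ys j)

  covering : ListAssignment (K l n)
  covering = bySide l n (L ∘ xv l n) R.zs

  private
    covering-xv : ∀ i → covering (xv l n i) ≡ L (xv l n i)
    covering-xv = bySide-xv l n (L ∘ xv l n) R.zs

    covering-yv : ∀ j → covering (yv l n j) ≡ R.zs j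
    covering-yv = bySide-yv l n (L ∘ xv l n) R.zs

    ∈-covering-xv : ∀ {i a} → a ∈ covering (xv l n i) → a ∈ L (xv l n i)
    ∈-covering-xv {i} = subst (_ ∈_) (covering-xv i)

    ∈-covering-yv : ∀ {j a} → a ∈ covering (yv l n j) → a ∈ R.zs j
    ∈-covering-yv {j} = subst (_ ∈_) (covering-yv j)

  covering-assignment : IsAssignment (K l n) m covering
  covering-assignment v with side-view l n v
  ... | left i  = subst (λ xs → Unique xs × length xs ≡ m) (sym (covering-xv i)) (isA (xv l n i))
  ... | right j = subst (λ xs → Unique xs × length xs ≡ m) (sym (covering-yv j))
                    (R.zs-unique j , trans (R.zs-length j) (proj₂ (isA (yv l n j))))

  covering-covered : Covered l n covering
  covering-covered j c c∈ with All.lookup (R.zs⊆X j) (∈-covering-yv c∈)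
  ... | i , c∈L = i , subst (c ∈_) (sym (covering-xv i)) c∈L

  covering-colors : ∀ v {c} → c ∈ covering v → ∃[ u ] c ∈ L u
  covering-colors v c∈ with side-view l n v
  ... | left i  = xv l n i , ∈-covering-xv c∈
  ... | right j with All.lookup (R.zs⊆X j) (∈-covering-yv c∈)
  ...   | i , c∈L = xv l n i , c∈L

  covering-recoloring : Recoloring (K l n) covering L
  covering-recoloring = record
    { recolor           = recolor
    ; recolor-∈         = recolor-∈
    ; recolor-injective = recolor-injective
    ; recolor-adjacent  = recolor-adjacent
    }
    where
    recolor : Fin (l + n) → ℕ → ℕ
    recolor = bySide l n (λ _ → id) ρ.ρ

    recolor-xv : ∀ i a → recolor (xv l n i) a ≡ a
    recolor-xv i a = cong (λ f → f a) (bySide-xv l n (λ _ → id) ρ.ρ i)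

    recolor-yv : ∀ j a → recolor (yv l n j) a ≡ ρ.ρ j a
    recolor-yv j a = cong (λ f → f a) (bySide-yv l n (λ _ → id) ρ.ρ j)

    recolor-∈ : ∀ v {a} → a ∈ covering v → recolor v a ∈ L v
    recolor-∈ v a∈ with side-view l n v
    ... | left i  = subst (_∈ L (xv l n i)) (sym (recolor-xv i _)) (∈-covering-xv a∈)
    ... | right j = subst (_∈ L (yv l n j)) (sym (recolor-yv j _)) (ρ.ρ-∈ j (∈-covering-yv a∈))

    recolor-injective : ∀ v {a b} → a ∈ covering v → b ∈ covering v → recolor v a ≡ recolor v b → a ≡ b
    recolor-injective v {a} {b} a∈ b∈ ρa≡ρb with side-view l n v
    ... | left i  = trans (sym (recolor-xv i a)) (trans ρa≡ρb (recolor-xv i b))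
    ... | right j = ρ.ρ-injective j (∈-covering-yv a∈) (∈-covering-yv b∈)
                      (trans (sym (recolor-yv j a)) (trans ρa≡ρb (recolor-yv j b)))

    -- Colors of x-vertices lie in InX, and the repair injections fix whatever they send there.
    recolor-adjacent-xy : ∀ i j {a b} → a ∈ covering (xv l n i) → b ∈ covering (yv l n j)
              → recolor (xv l n i) a ≡ recolor (yv l n j) b → a ≡ b
    recolor-adjacent-xy i j {a} {b} a∈ b∈ ρa≡ρb =
      trans a≡ρb (ρ.ρ-fixes j (∈-covering-yv b∈) (i , subst (_∈ L (xv l n i)) a≡ρb (∈-covering-xv a∈)))
      where
      a≡ρb : a ≡ ρ.ρ j b
      a≡ρb = trans (sym (recolor-xv i a)) (trans ρa≡ρb (recolor-yv j b))

    recolor-adjacent : ∀ u v {a b} → Adj (K l n) u v ≡ true → a ∈ covering u → b ∈ covering v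
                     → recolor u a ≡ recolor v b → a ≡ b
    recolor-adjacent u v uv with side-view l n u | side-view l n v
    ... | left i  | left i′  = ⊥-elim (xv-xv-nonadjacent l n i i′ uv)
    ... | right j | right j′ = ⊥-elim (yv-yv-nonadjacent l n j j′ uv)
    ... | left i  | right j  = recolor-adjacent-xy i j
    ... | right j | left i   = λ a∈ b∈ ρa≡ρb → sym (recolor-adjacent-xy i j b∈ a∈ (sym ρa≡ρb))

  covering-≤ : P (K l n) covering ≤ P (K l n) L
  covering-≤ = P-mono covering-recoloring (proj₁ ∘ covering-assignment)

module _ (G : Graph) {m : ℕ} (L : ListAssignment G) (isA : IsAssignment G m L) where

  private
    palette : List ℕ
    palette = colors (N G) L

    encode decode : ℕ → ℕ
    encode c = position c palette
    decode = nth palette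

    decode∘encode≡id : ∀ v {c} → c ∈ L v → decode (encode c) ≡ c
    decode∘encode≡id v c∈ = nth-position palette (∈-colors⁺ (N G) L v c∈)

  compressed : ListAssignment G
  compressed = renamed {G} L encode decode decode∘encode≡id

  compressed-assignment : IsAssignment G m compressed
  compressed-assignment v =
    renamed⁺ {G} L encode decode decode∘encode≡id v (proj₁ (isA v)) ,
    trans (length-map encode (L v)) (proj₂ (isA v))

  compressed-< : ∀ v {c} → c ∈ compressed v → c < N G * m
  compressed-< v c∈ with ∈-map⁻ encode c∈
  ... | c , c∈L , refl = subst (encode c <_) (length-colors (N G) L (proj₂ ∘ isA))
                           (position-< palette (∈-colors⁺ (N G) L v c∈L))

  compressed-≤ : P G compressed ≤ P G L
  compressed-≤ = P-mono (renaming-recoloring {G} L encode decode decode∘encode≡id) (proj₁ ∘ compressed-assignment)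

P-lookup∘tabulate : ∀ {G} (L : ListAssignment G) → (∀ v → Unique (L v)) → P G (lookup (tabulate L)) ≤ P G L
P-lookup∘tabulate L uL = P-mono (pointwise-recoloring (lookup∘tabulate L))
  (λ v → subst Unique (sym (lookup∘tabulate L v)) (uL v))

Bounded : (G : Graph) → ℕ → ListAssignment G → Set
Bounded G B L = ∀ v {c} → c ∈ L v → c < B

module _ (l n m : ℕ) where

  Good : ListAssignment (K l n) → Set
  Good L = IsAssignment (K l n) m L × Covered l n L

  good? : Decidable Good
  good? L = Fin.all? (λ v → unique? (L v) ×-dec (length (L v) ≟ m))
            ×-dec map′ (λ covers j c c∈ → All.lookup (covers j) c∈) (λ covered j → All.tabulate (covered j _))
                    (Fin.all? λ j → All.all? (λ c → Fin.any? λ i → c ∈? L (xv l n i)) (L (yv l n j)))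

  Good-resp : ∀ {L L′} → (∀ v → L v ≡ L′ v) → Good L → Good L′
  Good-resp L≗L′ (isA , covered) =
    (λ v → subst (λ xs → Unique xs × length xs ≡ m) (L≗L′ v) (isA v)) ,
    λ j c c∈ → let i , c∈L = covered j c (subst (c ∈_) (sym (L≗L′ (yv l n j))) c∈)
               in i , subst (c ∈_) (L≗L′ (xv l n i)) c∈L

  boundedAssignments : ℕ → List (Vec (List ℕ) (l + n))
  boundedAssignments B = vectorsOver (l + n) (listsOver m (upTo B))

  candidates : ℕ → List (Vec (List ℕ) (l + n))
  candidates B = filter (good? ∘ lookup) (boundedAssignments B)

  tabulate-∈-candidates : ∀ {B L} → Good L → Bounded (K l n) B L → tabulate L ∈ candidates B
  tabulate-∈-candidates {B} {L} good bounded =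
    ∈-filter⁺ (good? ∘ lookup) (∈-vectorsOver⁺ (tabulate L) tabulate-∈) (Good-resp L≗ good)
    where
    L≗ : ∀ v → L v ≡ lookup (tabulate L) v
    L≗ v = sym (lookup∘tabulate L v)
    tabulate-∈ : ∀ v → lookup (tabulate L) v ∈ listsOver m (upTo B)
    tabulate-∈ v = subst (_∈ listsOver m (upTo B)) (L≗ v)
      (subst (λ k → L v ∈ listsOver k (upTo B)) (proj₂ (proj₁ good v))
        (∈-listsOver⁺ (L v) (All.tabulate (∈-upTo⁺ ∘ bounded v))))

  DominatedByGood : ℕ → Set
  DominatedByGood B = ∀ L → IsAssignment (K l n) m L
    → ∃[ L* ] (Good L* × Bounded (K l n) B L* × P (K l n) L* ≤ P (K l n) L)

  representative : ∀ {B} → DominatedByGood B → ∀ L → IsAssignment (K l n) m L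
    → ∃[ V ] (V ∈ candidates B × P (K l n) (lookup V) ≤ P (K l n) L)
  representative dominated L isA with dominated L isA
  ... | L* , good , bounded , L*≤L =
    tabulate L* , tabulate-∈-candidates good bounded ,
    ≤-trans (P-lookup∘tabulate L* (proj₁ ∘ proj₁ good)) L*≤L

  upTo-assignment : IsAssignment (K l n) m (λ _ → upTo m)
  upTo-assignment _ = Unique.upTo⁺ m , length-upTo m

  good-minimiser : ∀ B → DominatedByGood B → ∃[ L ] (Good L × AttainsPℓ (K l n) m L)
  good-minimiser B dominated
    with ∃-minimal (P (K l n) ∘ lookup) (proj₁ (proj₂ (representative dominated (λ _ → upTo m) upTo-assignment)))
  ... | best , best∈ , minimal =
    lookup best , proj₂ (∈-filter⁻ (good? ∘ lookup) {xs = boundedAssignments B} best∈) , attains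
    where
    attains : AttainsPℓ (K l n) m (lookup best)
    attains L isA with representative dominated L isA
    ... | V , V∈ , V≤L = ≤-trans (All.lookup minimal V∈) V≤L

dominated-by-covering : ∀ l n {m} → Fin l → DominatedByGood l n m ((l + n) * m)
dominated-by-covering l n {m} x₀ L isA =
  covering l n x₀ L′ isA′ ,
  (covering-assignment l n x₀ L′ isA′ , covering-covered l n x₀ L′ isA′) ,
  bounded ,
  ≤-trans (covering-≤ l n x₀ L′ isA′) (compressed-≤ (K l n) L isA)
  where
  L′ : ListAssignment (K l n)
  L′ = compressed (K l n) L isA
  isA′ : IsAssignment (K l n) m L′
  isA′ = compressed-assignment (K l n) L isA
  bounded : Bounded (K l n) ((l + n) * m) (covering l n x₀ L′ isA′)
  bounded v c∈ with covering-colors l n x₀ L′ isA′ v c∈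
  ... | u , c∈L′ = compressed-< (K l n) L isA u c∈L′

lemma5 : (l n : ℕ) → 1 ≤ l → l ≤ n → (m : ℕ)
       → (∀ k → IsListChromaticNumber (K l n) k → k ≤ m)
       → ∃[ L ] (IsAssignment (K l n) m L
                 × (∀ (j : Fin n) (c : ℕ) → c ∈ L (yv l n j) → ∃[ i ] c ∈ L (xv l n i))
                 × AttainsPℓ (K l n) m L)
lemma5 zero    n ()  _ m _
lemma5 (suc l) n _ _ m _ =
  let L , (isA , covered) , attains = good-minimiser (suc l) n m ((suc l + n) * m)
                                        (dominated-by-covering (suc l) n zero)
  in L , isA , covered , attains
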